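{- For all integers $t,k\ge 1$, $\delta_{t,2}(\mathbb{Z}^2)\ge \delta_{t+k,2+2k}(\mathbb{Z}^2)$.
   Context: $\mathbb{Z}^2$ denotes the infinite grid graph, whose graph distance is the $\ell_1$ distance. For positive integers $t,r$, a set $\mathcal{T}\subseteq\mathbb{Z}^2$ is $(t,r)$ broadcasting if every vertex $v$ satisfies $\sum_{u\in\mathcal{T}}\max\{0,t-d(u,v)\}\ge r$. The density of $\mathcal{T}$ is $\limsup_{n\to\infty}\frac{|\mathcal{T}\cap[-n,n]^2|}{(2n+1)^2}$, and $\delta_{t,r}(\mathbb{Z}^2)$ is the minimal density of a $(t,r)$ broadcasting set in $\mathbb{Z}^2$. -}

module Defs where

open import Data.Bool using (Bool; true; false; if_then_else_)
open import Data.Nat using (ℕ; zero; suc; _+_; _*_; _∸_; _≤_)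
open import Data.Integer using (ℤ; +_; ∣_∣) renaming (_-_ to _-ℤ_; _+_ to _+ℤ_)
open import Data.List using (List; map; upTo; concatMap)
open import Data.Nat.ListAction using (sum)
open import Data.Product using (_×_; _,_; ∃; Σ)

Point : Set
Point = ℤ × ℤ

TowerSet : Set
TowerSet = Point → Bool

-- Graph distance of ℤ² (ℓ₁ distance).
dist : Point → Point → ℕ
dist (x , y) (x' , y') = ∣ x -ℤ x' ∣ + ∣ y -ℤ y' ∣

range : ℕ → List ℤ
range n = map (λ i → (+ i) -ℤ (+ n)) (upTo (suc (n + n)))

box : ℕ → Point → List Point
box n (x , y) = concatMap (λ i → map (λ j → (x +ℤ i , y +ℤ j)) (range n)) (range n)

-- Total signal Σ_{u ∈ 𝒯} max{0, t - d(u,v)}.  Only towers with d(u,v) < t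
-- contribute, and all of them lie in the box v + [-t,t]², so the infinite sum
-- equals this finite one (t ∸ d is max{0, t - d}).
signal : ℕ → TowerSet → Point → ℕ
signal t T v = sum (map (λ u → if T u then t ∸ dist u v else 0) (box t v))

Broadcasting : ℕ → ℕ → TowerSet → Set
Broadcasting t r T = ∀ v → r ≤ signal t T v

count : TowerSet → ℕ → ℕ
count T n = sum (map (λ u → if T u then 1 else 0) (box n (+ 0 , + 0)))

-- limsup_{n→∞} |𝒯 ∩ [-n,n]²| / (2n+1)² ≤ a/b, i.e.
-- for every ε = 1/(m+1) eventually |𝒯 ∩ [-n,n]²|/(2n+1)² ≤ a/b + 1/(m+1).
DensityAtMost : TowerSet → ℕ → ℕ → Set
DensityAtMost T a b =
  ∀ (m : ℕ) → ∃ λ (N : ℕ) → ∀ (n : ℕ) → N ≤ n →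
    count T n * b * suc m ≤ (a * suc m + b) * (suc (n + n) * suc (n + n))

-- δ_{t,r}(ℤ²) ≤ a/b, where δ_{t,r} is the infimum (= minimum) of the densities
-- of (t,r) broadcasting sets: for every ε = 1/(m+1) there is a (t,r)
-- broadcasting set of density ≤ a/b + 1/(m+1) = (a(m+1)+b)/(b(m+1)).
MinDensityAtMost : ℕ → ℕ → ℕ → ℕ → Set
MinDensityAtMost t r a b =
  ∀ (m : ℕ) → Σ TowerSet λ T →
    Broadcasting t r T × DensityAtMost T (a * suc m + b) (b * suc m)

-- A (t,2) broadcasting set is already (t+k, 2+2k) broadcasting, so every set witnessing
-- the density bound for (t,2) witnesses it for (t+k, 2+2k) as well.  At a vertex v take
-- a tower x with d(x,v) < t and write t = d(x,v) + 1 + s.  If s > k, then x alone sends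
-- t + k - d(x,v) ≥ 2 + 2k.  Otherwise walk s steps from v directly away from x, to w.
-- There x sends only 1, so another tower y has d(y,w) < t, hence d(y,v) < t + s, and x
-- and y together send (s + 1 + k) + (k - s + 1) = 2 + 2k to v.
module Submission where

open import Algebra.Bundles using (AbelianGroup)
open import Data.Bool using (true; false; if_then_else_)
open import Data.Integer as ℤ using (ℤ; +_; -[1+_]; ∣_∣; -_; _-_)
import Data.Integer.Properties as ℤ
import Data.Integer.Tactic.RingSolver as ℤ-Solver
open import Data.List using ([]; _∷_; _++_; map; concatMap; cartesianProductWith)
open import Data.List.Membership.Propositional using (_∈_)
open import Data.List.Membership.Propositional.Properties
  using (∈-map⁺; ∈-upTo⁺; ∈-cartesianProductWith⁺)
open import Data.List.Relation.Unary.All using (lookup)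
open import Data.List.Relation.Unary.AllPairs using (_∷_)
open import Data.List.Relation.Unary.Any using (here; there)
open import Data.List.Relation.Unary.Unique.Propositional using (Unique)
import Data.List.Relation.Unary.Unique.Propositional.Properties as Unique
open import Data.Nat using (ℕ; zero; suc; _+_; _*_; _∸_; _≤_; _<_; z≤n; s≤s; z<s; _<?_)
open import Data.Nat.ListAction using (sum)
open import Data.Nat.Properties
import Data.Nat.Tactic.RingSolver as ℕ-Solver
open import Data.Product using (∃; _×_; _,_)
open import Data.Product.Properties using (≡-dec; ×-≡,≡←≡)
open import Data.Sum using (inj₁; inj₂)
open import Relation.Binary.Definitions using (DecidableEquality)
open import Relation.Binary.PropositionalEquality
open import Relation.Nullary using (yes; no; contradiction)

open import Defs
open import Algebra.Properties.Group (AbelianGroup.group ℤ.+-0-abelianGroup) using (∙-cancelˡ; ∙-cancelʳ)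
open import Algebra.Properties.CommutativeSemigroup +-commutativeSemigroup using (interchange; xy∙z≈xz∙y)

module _ {A : Set} (f : A → ℕ) where

  ∈⇒≤sum : ∀ {x xs} → x ∈ xs → f x ≤ sum (map f xs)
  ∈⇒≤sum {xs = _ ∷ _} (here refl) = m≤m+n _ _
  ∈⇒≤sum {xs = y ∷ _} (there x∈) = ≤-trans (∈⇒≤sum x∈) (m≤n+m _ (f y))

  ∈-≢⇒+≤sum : ∀ {x y xs} → x ∈ xs → y ∈ xs → x ≢ y → f x + f y ≤ sum (map f xs)
  ∈-≢⇒+≤sum (here refl) (here refl) x≢y = contradiction refl x≢y
  ∈-≢⇒+≤sum {x} (here refl) (there y∈) _ = +-monoʳ-≤ (f x) (∈⇒≤sum y∈)
  ∈-≢⇒+≤sum {x} {y} {_ ∷ zs} (there x∈) (here refl) _ = begin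
    f x + f y           ≡⟨ +-comm (f x) (f y) ⟩
    f y + f x           ≤⟨ +-monoʳ-≤ (f y) (∈⇒≤sum x∈) ⟩
    f y + sum (map f zs) ∎
    where open ≤-Reasoning
  ∈-≢⇒+≤sum {xs = z ∷ _} (there x∈) (there y∈) x≢y =
    ≤-trans (∈-≢⇒+≤sum x∈ y∈ x≢y) (m≤n+m _ (f z))

  1≤sum⇒∃ : ∀ {xs} → 1 ≤ sum (map f xs) → ∃ λ y → y ∈ xs × 1 ≤ f y
  1≤sum⇒∃ {z ∷ zs} 1≤sum with f z in fz≡
  ... | suc _ = z , here refl , subst (1 ≤_) (sym fz≡) z<s
  ... | zero with 1≤sum⇒∃ {zs} 1≤sum
  ...   | y , y∈ , 1≤fy = y , there y∈ , 1≤fy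

  <sum⇒∃≢ : DecidableEquality A → ∀ x {xs} → Unique xs → f x < sum (map f xs) →
            ∃ λ y → y ∈ xs × y ≢ x × 1 ≤ f y
  <sum⇒∃≢ _≟_ x {z ∷ zs} (z∉zs ∷ _) fx<sum with z ≟ x
  ... | yes refl
    with 1≤sum⇒∃ {zs} (+-cancelˡ-≤ (f x) 1 _ (subst (_≤ f x + sum (map f zs)) (+-comm 1 (f x)) fx<sum))
  ...   | y , y∈ , 1≤fy = y , there y∈ , (λ { refl → lookup z∉zs y∈ refl }) , 1≤fy
  <sum⇒∃≢ _≟_ x {z ∷ zs} (_ ∷ zs!) fx<sum | no z≢x with f z in fz≡
  ... | suc _ = z , here refl , z≢x , subst (1 ≤_) (sym fz≡) z<s
  ... | zero with <sum⇒∃≢ _≟_ x zs! fx<sum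
  ...   | y , y∈ , y≢x , 1≤fy = y , there y∈ , y≢x , 1≤fy

concatMap-map≡cartesianProductWith : ∀ {A B C : Set} (g : A → B → C) xs ys →
  concatMap (λ i → map (g i) ys) xs ≡ cartesianProductWith g xs ys
concatMap-map≡cartesianProductWith g [] ys = refl
concatMap-map≡cartesianProductWith g (x ∷ xs) ys =
  cong (map (g x) ys ++_) (concatMap-map≡cartesianProductWith g xs ys)

translate : Point → ℤ → ℤ → Point
translate (x , y) i j = (x ℤ.+ i , y ℤ.+ j)

box≡cartesianProductWith : ∀ n v → box n v ≡ cartesianProductWith (translate v) (range n) (range n)
box≡cartesianProductWith n v = concatMap-map≡cartesianProductWith (translate v) (range n) (range n)

[i+j]-j≡i : ∀ i j → (i ℤ.+ j) - j ≡ i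
[i+j]-j≡i = ℤ-Solver.solve-∀

i+[j-i]≡j : ∀ i j → i ℤ.+ (j - i) ≡ j
i+[j-i]≡j = ℤ-Solver.solve-∀

∣i∣≤n⇒i+n≡+k : ∀ {n} i → ∣ i ∣ ≤ n → ∃ λ k → k ≤ n + n × + k ≡ i ℤ.+ + n
∣i∣≤n⇒i+n≡+k {n} (+ m) m≤n = m + n , +-monoˡ-≤ n m≤n , refl
∣i∣≤n⇒i+n≡+k {n} -[1+ m ] m<n =
  n ∸ suc m , ≤-trans (m∸n≤m n (suc m)) (m≤m+n n n) , sym (ℤ.⊖-≥ m<n)

∈-range : ∀ {n} i → ∣ i ∣ ≤ n → i ∈ range n
∈-range {n} i ∣i∣≤n with k , k≤2n , k≡i+n ← ∣i∣≤n⇒i+n≡+k i ∣i∣≤n =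
  subst (_∈ range n) (trans (cong (_- + n) k≡i+n) ([i+j]-j≡i i (+ n)))
    (∈-map⁺ (λ j → + j - + n) (∈-upTo⁺ (s≤s k≤2n)))

range-unique : ∀ n → Unique (range n)
range-unique n = Unique.map⁺ (λ {i} {j} eq → ℤ.+-injective (∙-cancelʳ (- + n) (+ i) (+ j) eq))
  (Unique.upTo⁺ _)

∈-box : ∀ {n} u v → dist u v ≤ n → u ∈ box n v
∈-box {n} (a , b) (x , y) d≤n =
  subst₂ _∈_ (cong₂ _,_ (i+[j-i]≡j x a) (i+[j-i]≡j y b)) (sym (box≡cartesianProductWith n (x , y)))
    (∈-cartesianProductWith⁺ (translate (x , y))
      (∈-range (a - x) (m+n≤o⇒m≤o _ d≤n)) (∈-range (b - y) (m+n≤o⇒n≤o _ d≤n)))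

box-unique : ∀ n v → Unique (box n v)
box-unique n (x , y) = subst Unique (sym (box≡cartesianProductWith n (x , y)))
  (Unique.cartesianProductWith⁺ (translate (x , y)) translate-injective
    (range-unique n) (range-unique n))
  where
  translate-injective : ∀ {i i′ j j′} →
                        translate (x , y) i j ≡ translate (x , y) i′ j′ → i ≡ i′ × j ≡ j′
  translate-injective eq with eq₁ , eq₂ ← ×-≡,≡←≡ eq = ∙-cancelˡ x _ _ eq₁ , ∙-cancelˡ y _ _ eq₂

∣i-k∣≤∣i-j∣+∣j-k∣ : ∀ i j k → ∣ i - k ∣ ≤ ∣ i - j ∣ + ∣ j - k ∣
∣i-k∣≤∣i-j∣+∣j-k∣ i j k =
  subst (λ l → ∣ l ∣ ≤ ∣ i - j ∣ + ∣ j - k ∣) (ℤ.+-minus-telescope i j k) (ℤ.∣i+j∣≤∣i∣+∣j∣ (i - j) (j - k))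

dist-triangle : ∀ u w v → dist u v ≤ dist u w + dist w v
dist-triangle (a , b) (c , d) (e , f) = ≤-trans
  (+-mono-≤ (∣i-k∣≤∣i-j∣+∣j-k∣ a c e) (∣i-k∣≤∣i-j∣+∣j-k∣ b d f))
  (≤-reflexive (interchange (∣ a - c ∣) (∣ c - e ∣) (∣ b - d ∣) (∣ d - f ∣)))

∣-∣-step-away : ∀ a p s → ∃ λ p′ → ∣ a - p′ ∣ ≡ ∣ a - p ∣ + s × ∣ p′ - p ∣ ≡ s
∣-∣-step-away a p s with ℤ.+∣i∣≡i⊎+∣i∣≡-i (a - p)
... | inj₁ +∣a-p∣≡a-p = p - + s , (begin
  ∣ a - (p - + s) ∣     ≡⟨ cong ∣_∣ (left a p (+ s)) ⟩
  ∣ (a - p) ℤ.+ + s ∣   ≡⟨ cong (λ i → ∣ i ℤ.+ + s ∣) (sym +∣a-p∣≡a-p) ⟩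
  ∣ a - p ∣ + s         ∎) , (begin
  ∣ (p - + s) - p ∣     ≡⟨ cong ∣_∣ (left-step p (+ s)) ⟩
  ∣ - (+ s) ∣           ≡⟨ ℤ.∣-i∣≡∣i∣ (+ s) ⟩
  s                     ∎)
  where
  open ≡-Reasoning
  left : ∀ a p j → a - (p - j) ≡ (a - p) ℤ.+ j
  left = ℤ-Solver.solve-∀
  left-step : ∀ p j → (p - j) - p ≡ - j
  left-step = ℤ-Solver.solve-∀
... | inj₂ +∣a-p∣≡p-a = p ℤ.+ + s , (begin
  ∣ a - (p ℤ.+ + s) ∣         ≡⟨ cong ∣_∣ (right a p (+ s)) ⟩
  ∣ - (- (a - p) ℤ.+ + s) ∣   ≡⟨ ℤ.∣-i∣≡∣i∣ (- (a - p) ℤ.+ + s) ⟩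
  ∣ - (a - p) ℤ.+ + s ∣       ≡⟨ cong (λ i → ∣ i ℤ.+ + s ∣) (sym +∣a-p∣≡p-a) ⟩
  ∣ a - p ∣ + s               ∎) , cong ∣_∣ (right-step p (+ s))
  where
  open ≡-Reasoning
  right : ∀ a p j → a - (p ℤ.+ j) ≡ - (- (a - p) ℤ.+ j)
  right = ℤ-Solver.solve-∀
  right-step : ∀ p j → (p ℤ.+ j) - p ≡ j
  right-step = ℤ-Solver.solve-∀

dist-step-away : ∀ u v s → ∃ λ w → dist u w ≡ dist u v + s × dist w v ≡ s
dist-step-away (a , b) (p , q) s with p′ , ∣a-p′∣≡ , ∣p′-p∣≡s ← ∣-∣-step-away a p s =
  (p′ , q) , (begin
    ∣ a - p′ ∣ + ∣ b - q ∣        ≡⟨ cong (_+ ∣ b - q ∣) ∣a-p′∣≡ ⟩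
    ∣ a - p ∣ + s + ∣ b - q ∣     ≡⟨ xy∙z≈xz∙y (∣ a - p ∣) s (∣ b - q ∣) ⟩
    ∣ a - p ∣ + ∣ b - q ∣ + s     ∎) , (begin
    ∣ p′ - p ∣ + ∣ q - q ∣        ≡⟨ cong₂ _+_ ∣p′-p∣≡s (cong ∣_∣ (ℤ.+-inverseʳ q)) ⟩
    s + 0                         ≡⟨ +-identityʳ s ⟩
    s                             ∎)
  where open ≡-Reasoning

contribution : ℕ → TowerSet → Point → Point → ℕ
contribution t T v u = if T u then t ∸ dist u v else 0

record Sends (T : TowerSet) (t c : ℕ) (u v : Point) : Set where
  constructor _,_
  field
    tower : T u ≡ true
    reach : c + dist u v ≤ t

module _ {T : TowerSet} where

  contribution≤ : ∀ t v u → contribution t T v u ≤ t ∸ dist u v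
  contribution≤ t v u with T u
  ... | true = ≤-refl
  ... | false = z≤n

  Sends⇒≤contribution : ∀ {t c u v} → Sends T t c u v → c ≤ contribution t T v u
  Sends⇒≤contribution {c = c} (Tu , c+d≤t) rewrite Tu = m+n≤o⇒m≤o∸n c c+d≤t

  positive-contribution⇒Sends : ∀ {t u v} → 1 ≤ contribution t T v u → Sends T t 1 u v
  positive-contribution⇒Sends {u = u} 0<c with T u in Tu
  ... | true = Tu , m∸n≢0⇒n<m (m>n⇒m∸n≢0 0<c)

  Sends⇒≤signal : ∀ {t c u v} → Sends T t c u v → c ≤ signal t T v
  Sends⇒≤signal {t} {c} {u} {v} sends@(_ , c+d≤t) =
    ≤-trans (Sends⇒≤contribution sends)
      (∈⇒≤sum (contribution t T v) (∈-box u v (m+n≤o⇒n≤o c c+d≤t)))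

  Sends-pair⇒≤signal : ∀ {t c c′ u u′ v} → u ≢ u′ → Sends T t c u v → Sends T t c′ u′ v →
                       c + c′ ≤ signal t T v
  Sends-pair⇒≤signal {t} {c} {c′} {u} {u′} {v} u≢u′ sends@(_ , c+d≤t) sends′@(_ , c′+d′≤t) =
    ≤-trans (+-mono-≤ (Sends⇒≤contribution sends) (Sends⇒≤contribution sends′))
      (∈-≢⇒+≤sum (contribution t T v)
        (∈-box u v (m+n≤o⇒n≤o c c+d≤t)) (∈-box u′ v (m+n≤o⇒n≤o c′ c′+d′≤t)) u≢u′)

  1≤signal⇒Sends : ∀ {t v} → 1 ≤ signal t T v → ∃ λ u → Sends T t 1 u v
  1≤signal⇒Sends {t} {v} 1≤signal with u , _ , 0<c ← 1≤sum⇒∃ (contribution t T v) {box t v} 1≤signal =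
    u , positive-contribution⇒Sends 0<c

  Sends-shift : ∀ {t c u v} k → Sends T t c u v → Sends T (t + k) (c + k) u v
  Sends-shift {c = c} {u} {v} k (Tu , c+d≤t) =
    Tu , ≤-trans (≤-reflexive (xy∙z≈xz∙y c k (dist u v))) (+-monoˡ-≤ k c+d≤t)

  Sends-relay : ∀ {t c u w v} → Sends T t c u w → Sends T (t + dist w v) c u v
  Sends-relay {t} {c} {u} {w} {v} (Tu , c+d≤t) = Tu , (begin
    c + dist u v                 ≤⟨ +-monoʳ-≤ c (dist-triangle u w v) ⟩
    c + (dist u w + dist w v)    ≡⟨ +-assoc c (dist u w) (dist w v) ⟨
    c + dist u w + dist w v      ≤⟨ +-monoˡ-≤ (dist w v) c+d≤t ⟩
    t + dist w v                 ∎)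
    where open ≤-Reasoning

  contribution-from-afar≤1 : ∀ {t x w} → t ≤ suc (dist x w) → contribution t T w x ≤ 1
  contribution-from-afar≤1 {t} {x} {w} t≤1+d = begin
    contribution t T w x        ≤⟨ contribution≤ t w x ⟩
    t ∸ dist x w                ≤⟨ ∸-monoˡ-≤ (dist x w) t≤1+d ⟩
    suc (dist x w) ∸ dist x w   ≡⟨ m+n∸n≡m 1 (dist x w) ⟩
    1                           ∎
    where open ≤-Reasoning

  other-tower : ∀ {t x w} → Broadcasting t 2 T → t ≤ suc (dist x w) →
                ∃ λ y → y ≢ x × Sends T t 1 y w
  other-tower {t} {x} {w} broadcasting t≤1+d
    with y , _ , y≢x , 0<c ← <sum⇒∃≢ (contribution t T w) (≡-dec ℤ._≟_ ℤ._≟_) x (box-unique t w)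
                               (≤-trans (s≤s (contribution-from-afar≤1 t≤1+d)) (broadcasting w)) =
    y , y≢x , positive-contribution⇒Sends 0<c

  Sends-exactly : ∀ {t x v} s → T x ≡ true → suc (dist x v + s) ≡ t → Sends T t (suc s) x v
  Sends-exactly {x = x} {v} s Tx refl = Tx , s≤s (≤-reflexive (+-comm s (dist x v)))

  two-towers : ∀ {t x y v} s r → x ≢ y → T x ≡ true → suc (dist x v + s) ≡ t →
               Sends T (t + s) 1 y v → 2 + 2 * (s + r) ≤ signal (t + (s + r)) T v
  two-towers {t} {y = y} {v} s r x≢y Tx t≡ y-sends = begin
    2 + 2 * (s + r)            ≡⟨ total s r ⟩
    suc s + (s + r) + suc r    ≤⟨ Sends-pair⇒≤signal x≢y (Sends-shift (s + r) (Sends-exactly s Tx t≡)) y-sends′ ⟩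
    signal (t + (s + r)) T v   ∎
    where
    open ≤-Reasoning
    y-sends′ : Sends T (t + (s + r)) (suc r) y v
    y-sends′ = subst (λ t′ → Sends T t′ (suc r) y v) (+-assoc t s r) (Sends-shift r y-sends)
    total : ∀ s r → 2 + 2 * (s + r) ≡ suc s + (s + r) + suc r
    total = ℕ-Solver.solve-∀

  lift-from-tower : ∀ {t x v} s k → Broadcasting t 2 T → T x ≡ true → suc (dist x v + s) ≡ t →
                    2 + 2 * k ≤ signal (t + k) T v
  lift-from-tower {t} {x} {v} s k broadcasting Tx t≡ with k <? s
  ... | yes k<s = begin
    2 + 2 * k              ≡⟨ cong (λ n → 2 + (k + n)) (+-identityʳ k) ⟩
    suc (suc k) + k        ≤⟨ +-monoˡ-≤ k (s≤s k<s) ⟩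
    suc s + k              ≤⟨ Sends⇒≤signal (Sends-shift k (Sends-exactly s Tx t≡)) ⟩
    signal (t + k) T v     ∎
    where open ≤-Reasoning
  ... | no k≮s
    with r , refl ← m≤n⇒∃[o]m+o≡n (≮⇒≥ k≮s)
       | w , dxw≡d+s , dwv≡s ← dist-step-away x v s
    with y , y≢x , y-sends ← other-tower broadcasting
                                (≤-reflexive (trans (sym t≡) (cong suc (sym dxw≡d+s)))) =
    two-towers s r (≢-sym y≢x) Tx t≡ (subst (λ e → Sends T (t + e) 1 y v) dwv≡s (Sends-relay y-sends))

  broadcasting-lift : ∀ {t} k → Broadcasting t 2 T → Broadcasting (t + k) (2 + 2 * k) T
  broadcasting-lift {t} k broadcasting v
    with x , (Tx , 1+d≤t) ← 1≤signal⇒Sends {t} {v} (≤-trans (n≤1+n 1) (broadcasting v)) =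
    lift-from-tower {t} {x} {v} (t ∸ suc (dist x v)) k broadcasting Tx (m+[n∸m]≡n 1+d≤t)

proposition7 : (t k : ℕ) → 1 ≤ t → 1 ≤ k →
    (a b : ℕ) → 1 ≤ b →
    MinDensityAtMost t 2 a b → MinDensityAtMost (t + k) (2 + 2 * k) a b
proposition7 t k _ _ a b _ H m with T , broadcasting , density ← H m =
  T , broadcasting-lift {T = T} k broadcasting , density
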